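{- Let $q\ge 2$ be a power of a prime, let $s$ be an integer with $1<s<q$ and $\bar{s}=q-s$. (i) Let $k$ and $l$ be positive integers with $l\geq k$. Then $$[1^k0]_q+\sum_{j=k+1}^{l}(q^j-1)<q^{l+1}-1.$$ (ii) Suppose a positive integer $b$ can be written as $b=r_k+\sum_{j=k+1}^{\infty}\varepsilon_j(q^j-1)$, where $r_k$ is an integer with $[\bar{s}^k]_q\le r_k\le[1^k0]_q$, $\varepsilon_j\in\{0,1\}$ for $j\ge k+1$, not all $\varepsilon_j$ are $0$, and $\varepsilon_j=0$ for all sufficiently large $j$. Then $$\max\{j\geq k+1:\varepsilon_j=1\}=\max\{j\in\mathbb{N}: q^j-1\leq b\}.$$
   Context: For a word $w$ over $\{0,\dots,q-1\}$, $[w]_q$ denotes the integer whose base-$q$ expansion is $w$, and $x^m$ denotes $m$ copies of the letter $x$. Thus $[1^k0]_q=q\frac{q^k-1}{q-1}$ and $[\bar{s}^k]_q=\bar{s}\frac{q^k-1}{q-1}$. -}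

module Defs where

open import Data.Nat using (ℕ; zero; suc; _+_; _*_; _∸_; _^_; _≤_; _<_)
open import Data.Nat.Primality using (Prime)
open import Data.List using (List; []; _∷_; foldl; replicate; _++_; map; upTo)
open import Data.Nat.ListAction using (sum)
open import Data.Product using (Σ; _×_; ∃)
open import Relation.Binary.PropositionalEquality using (_≡_)

-- [w]_q : the integer whose base-q expansion is the word w (most significant digit first)
⟦_⟧_ : List ℕ → ℕ → ℕ
⟦ w ⟧ q = foldl (λ acc d → acc * q + d) 0 w

IsPrimePower : ℕ → Set
IsPrimePower q = Σ ℕ λ p → Σ ℕ λ n → Prime p × q ≡ p ^ suc n

-- Σ_{j=k+1}^{l} f j  (empty when l ≤ k)
sumFromTo : ℕ → ℕ → (ℕ → ℕ) → ℕ
sumFromTo k l f = sum (map (λ i → f (suc (k + i))) (upTo (l ∸ k)))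

IsMax : (ℕ → Set) → ℕ → Set
IsMax P m = P m × (∀ j → P j → j ≤ m)

module Submission where

-- Both parts rest on one geometric estimate: whenever  A + q ≤ q^(k+1)  (and q ≥ 2),
-- the inequality persists when the terms q^j − 1 for j = k+1, …, l are added:
--     A + Σ_{j=k+1}^{l} (q^j − 1) + q ≤ q^(l+1),
-- because each step adds less than q^(l+1) and 2·q^(l+1) ≤ q^(l+2).
-- The base case A = [1^k0]_q holds since [1^k]_q < q^k, so part (i) follows at once.
-- For part (ii), let m be the largest j with ε_j = 1.  All later terms vanish, so
-- b = r_k + Σ_{j=k+1}^{m} ε_j (q^j − 1); this contains the term q^m − 1, giving
-- q^m − 1 ≤ b, while bounding ε_j ≤ 1 and r_k ≤ [1^k0]_q, part (i) gives b < q^(m+1) − 1.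

open import Defs
open import Data.Nat using (ℕ; zero; suc; _+_; _*_; _∸_; _^_; _≤_; _<_; _≤′_; ≤′-reflexive; ≤′-step; z≤n; s≤s; >-nonZero)
open import Data.Nat.Properties
open import Data.List using (List; []; _∷_; replicate; _++_; map; upTo; foldl)
open import Data.List.Properties using (upTo-∷ʳ; map-++; foldl-++)
open import Data.Nat.ListAction using (sum)
open import Data.Nat.ListAction.Properties using (sum-++)
open import Data.Product using (Σ; _×_; _,_)
open import Data.Sum using (_⊎_; inj₁; inj₂)
open import Relation.Nullary using (yes; no; contradiction)
open import Relation.Binary.PropositionalEquality

sum-upTo-suc : (g : ℕ → ℕ) (n : ℕ) → sum (map g (upTo (suc n))) ≡ sum (map g (upTo n)) + g n
sum-upTo-suc g n = begin
    sum (map g (upTo (suc n)))           ≡⟨ cong (λ xs → sum (map g xs)) (sym (upTo-∷ʳ n)) ⟩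
    sum (map g (upTo n ++ n ∷ []))       ≡⟨ cong sum (map-++ g (upTo n) (n ∷ [])) ⟩
    sum (map g (upTo n) ++ g n ∷ [])     ≡⟨ sum-++ (map g (upTo n)) (g n ∷ []) ⟩
    sum (map g (upTo n)) + (g n + 0)     ≡⟨ cong (sum (map g (upTo n)) +_) (+-identityʳ (g n)) ⟩
    sum (map g (upTo n)) + g n           ∎
  where open ≡-Reasoning

sumFromTo-empty : (k : ℕ) (f : ℕ → ℕ) → sumFromTo k k f ≡ 0
sumFromTo-empty k f = cong (λ n → sum (map (λ i → f (suc (k + i))) (upTo n))) (n∸n≡0 k)

sumFromTo-step : {k l : ℕ} (f : ℕ → ℕ) → k ≤ l → sumFromTo k (suc l) f ≡ sumFromTo k l f + f (suc l)
sumFromTo-step {k} {l} f k≤l = begin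
    sum (map g (upTo (suc l ∸ k)))      ≡⟨ cong (λ n → sum (map g (upTo n))) (+-∸-assoc 1 k≤l) ⟩
    sum (map g (upTo (suc (l ∸ k))))    ≡⟨ sum-upTo-suc g (l ∸ k) ⟩
    sumFromTo k l f + g (l ∸ k)         ≡⟨ cong (λ j → sumFromTo k l f + f (suc j)) (m+[n∸m]≡n k≤l) ⟩
    sumFromTo k l f + f (suc l)         ∎
  where
    open ≡-Reasoning
    g : ℕ → ℕ
    g i = f (suc (k + i))

sum-map-mono : {A : Set} (g h : A → ℕ) → (∀ x → g x ≤ h x) → (xs : List A) →
    sum (map g xs) ≤ sum (map h xs)
sum-map-mono g h g≤h []       = z≤n
sum-map-mono g h g≤h (x ∷ xs) = +-mono-≤ (g≤h x) (sum-map-mono g h g≤h xs)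

sumFromTo-mono : (k l : ℕ) (f g : ℕ → ℕ) → (∀ j → k < j → f j ≤ g j) →
    sumFromTo k l f ≤ sumFromTo k l g
sumFromTo-mono k l f g f≤g =
  sum-map-mono (λ i → f (suc (k + i))) (λ i → g (suc (k + i)))
               (λ i → f≤g (suc (k + i)) (s≤s (m≤m+n k i))) (upTo (l ∸ k))

sumFromTo-vanishing-tail : {k m N : ℕ} (f : ℕ → ℕ) → k ≤ m → m ≤′ N →
    (∀ j → m < j → f j ≡ 0) → sumFromTo k N f ≡ sumFromTo k m f
sumFromTo-vanishing-tail f k≤m (≤′-reflexive refl) vanish = refl
sumFromTo-vanishing-tail {k} {m} {suc N} f k≤m (≤′-step m≤′N) vanish = begin
    sumFromTo k (suc N) f           ≡⟨ sumFromTo-step f (≤-trans k≤m (≤′⇒≤ m≤′N)) ⟩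
    sumFromTo k N f + f (suc N)     ≡⟨ cong (sumFromTo k N f +_) (vanish (suc N) (s≤s (≤′⇒≤ m≤′N))) ⟩
    sumFromTo k N f + 0             ≡⟨ +-identityʳ _ ⟩
    sumFromTo k N f                 ≡⟨ sumFromTo-vanishing-tail f k≤m m≤′N vanish ⟩
    sumFromTo k m f                 ∎
  where open ≡-Reasoning

last-term-≤-sumFromTo : {k m : ℕ} (f : ℕ → ℕ) → k < m → f m ≤ sumFromTo k m f
last-term-≤-sumFromTo {k} {suc m} f (s≤s k≤m) =
  ≤-trans (m≤n+m (f (suc m)) (sumFromTo k m f)) (≤-reflexive (sym (sumFromTo-step f k≤m)))

digit : ℕ → ℕ → ℕ → ℕ
digit q acc d = acc * q + d

-- Reading k copies of a digit d < q after the prefix value acc stays below (acc+1)·q^k;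
-- with acc = 0 this says [d^k]_q < q^k.
read-replicate-< : {q d : ℕ} → d < q → (acc k : ℕ) →
    foldl (digit q) acc (replicate k d) < suc acc * q ^ k
read-replicate-< {q} {d} d<q acc zero = ≤-reflexive (cong suc (sym (*-identityʳ acc)))
read-replicate-< {q} {d} d<q acc (suc k) = begin-strict
    foldl (digit q) (acc * q + d) (replicate k d)  <⟨ read-replicate-< d<q (acc * q + d) k ⟩
    suc (acc * q + d) * q ^ k                      ≤⟨ *-monoˡ-≤ (q ^ k) next-digit ⟩
    suc acc * q * q ^ k                            ≡⟨ *-assoc (suc acc) q (q ^ k) ⟩
    suc acc * q ^ suc k                            ∎
  where
    open ≤-Reasoning
    next-digit : suc (acc * q + d) ≤ suc acc * q
    next-digit = begin
      suc (acc * q + d)  ≡⟨ sym (+-suc (acc * q) d) ⟩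
      acc * q + suc d    ≤⟨ +-monoʳ-≤ (acc * q) d<q ⟩
      acc * q + q        ≡⟨ +-comm (acc * q) q ⟩
      suc acc * q        ∎

-- [1^k0]_q + q ≤ q^(k+1), i.e. [1^k0]_q = q·[1^k]_q ≤ q·(q^k − 1).
ones-zero-bound : {q : ℕ} → 2 ≤ q → (k : ℕ) → ⟦ replicate k 1 ++ (0 ∷ []) ⟧ q + q ≤ q ^ suc k
ones-zero-bound {q} q≥2 k = begin
    ⟦ replicate k 1 ++ (0 ∷ []) ⟧ q + q  ≡⟨ cong (_+ q) (foldl-++ (digit q) 0 (replicate k 1) (0 ∷ [])) ⟩
    ones * q + 0 + q                     ≡⟨ cong (_+ q) (+-identityʳ (ones * q)) ⟩
    ones * q + q                         ≡⟨ +-comm (ones * q) q ⟩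
    suc ones * q                         ≤⟨ *-monoˡ-≤ q (≤-trans (read-replicate-< q≥2 0 k)
                                                                 (≤-reflexive (+-identityʳ (q ^ k)))) ⟩
    q ^ k * q                            ≡⟨ *-comm (q ^ k) q ⟩
    q ^ suc k                            ∎
  where
    open ≤-Reasoning
    ones : ℕ
    ones = ⟦ replicate k 1 ⟧ q

repunitTail : ℕ → ℕ → ℕ → ℕ
repunitTail q k l = sumFromTo k l (λ j → q ^ j ∸ 1)

geometric-room : {q A k l : ℕ} → 2 ≤ q → A + q ≤ q ^ suc k → k ≤′ l →
    A + repunitTail q k l + q ≤ q ^ suc l
geometric-room {q} {A} {k} q≥2 room (≤′-reflexive refl)
  rewrite sumFromTo-empty k (λ j → q ^ j ∸ 1) | +-identityʳ A = room
geometric-room {q} {A} {k} {suc l} q≥2 room (≤′-step k≤′l) = begin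
    A + repunitTail q k (suc l) + q       ≡⟨ cong (λ t → A + t + q) (sumFromTo-step (λ j → q ^ j ∸ 1) (≤′⇒≤ k≤′l)) ⟩
    A + (repunitTail q k l + (P ∸ 1)) + q ≡⟨ rearrange A (repunitTail q k l) (P ∸ 1) q ⟩
    A + repunitTail q k l + q + (P ∸ 1)   ≤⟨ +-mono-≤ (geometric-room q≥2 room k≤′l) (m∸n≤m P 1) ⟩
    P + P                                 ≡⟨ cong (P +_) (sym (+-identityʳ P)) ⟩
    2 * P                                 ≤⟨ *-monoˡ-≤ P q≥2 ⟩
    q ^ suc (suc l)                       ∎
  where
    open ≤-Reasoning
    P : ℕ
    P = q ^ suc l
    rearrange : ∀ a t x c → a + (t + x) + c ≡ a + t + c + x
    rearrange a t x c = begin-equality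
      a + (t + x) + c  ≡⟨ cong (_+ c) (sym (+-assoc a t x)) ⟩
      a + t + x + c    ≡⟨ +-assoc (a + t) x c ⟩
      a + t + (x + c)  ≡⟨ cong (a + t +_) (+-comm x c) ⟩
      a + t + (c + x)  ≡⟨ sym (+-assoc (a + t) c x) ⟩
      a + t + c + x    ∎

room⇒<pred : {X Q q : ℕ} → 2 ≤ q → X + q ≤ Q → X < Q ∸ 1
room⇒<pred {X} q≥2 room = ∸-monoˡ-≤ 1 (≤-trans (≤-reflexive (+-comm 2 X)) (≤-trans (+-monoʳ-≤ X q≥2) room))

part-i : {q : ℕ} → 2 ≤ q → (k l : ℕ) → k ≤ l →
    ⟦ replicate k 1 ++ (0 ∷ []) ⟧ q + repunitTail q k l < q ^ suc l ∸ 1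
part-i q≥2 k l k≤l = room⇒<pred q≥2 (geometric-room q≥2 (ones-zero-bound q≥2 k) (≤⇒≤′ k≤l))

part-ii : {q : ℕ} → 2 ≤ q → (k b r : ℕ) (ε : ℕ → ℕ) (N : ℕ) →
    r ≤ ⟦ replicate k 1 ++ (0 ∷ []) ⟧ q →
    (∀ j → suc k ≤ j → ε j ≡ 0 ⊎ ε j ≡ 1) →
    (∀ j → N < j → ε j ≡ 0) →
    b ≡ r + sumFromTo k N (λ j → ε j * (q ^ j ∸ 1)) →
    (m : ℕ) → IsMax (λ j → suc k ≤ j × ε j ≡ 1) m →
    IsMax (λ j → q ^ j ∸ 1 ≤ b) m
part-ii {q} q≥2 k b r ε N r≤ binary finite refl m ((k<m , εm≡1) , m-max) = lower , upper
  where
    term : ℕ → ℕ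
    term j = ε j * (q ^ j ∸ 1)

    term≤ : ∀ j → k < j → term j ≤ q ^ j ∸ 1
    term≤ j k<j with binary j k<j
    ... | inj₁ εj≡0 rewrite εj≡0 = z≤n
    ... | inj₂ εj≡1 rewrite εj≡1 = ≤-reflexive (+-identityʳ _)

    term-vanishes : ∀ j → m < j → term j ≡ 0
    term-vanishes j m<j with binary j (<-trans k<m m<j)
    ... | inj₁ εj≡0 rewrite εj≡0 = refl
    ... | inj₂ εj≡1 = contradiction (m-max j (<-trans k<m m<j , εj≡1)) (<⇒≱ m<j)

    m≤N : m ≤ N
    m≤N with m ≤? N
    ... | yes m≤N = m≤N
    ... | no m≰N = contradiction (trans (sym εm≡1) (finite m (≰⇒> m≰N))) λ ()

    b≡ : r + sumFromTo k N term ≡ r + sumFromTo k m term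
    b≡ = cong (r +_) (sumFromTo-vanishing-tail term (<⇒≤ k<m) (≤⇒≤′ m≤N) term-vanishes)

    lower : q ^ m ∸ 1 ≤ r + sumFromTo k N term
    lower = begin
      q ^ m ∸ 1                   ≡⟨ sym (trans (cong (_* (q ^ m ∸ 1)) εm≡1) (+-identityʳ _)) ⟩
      term m                      ≤⟨ last-term-≤-sumFromTo term k<m ⟩
      sumFromTo k m term          ≤⟨ m≤n+m _ r ⟩
      r + sumFromTo k m term      ≡⟨ sym b≡ ⟩
      r + sumFromTo k N term      ∎
      where open ≤-Reasoning

    below-next : r + sumFromTo k N term < q ^ suc m ∸ 1
    below-next = begin-strict
      r + sumFromTo k N term      ≡⟨ b≡ ⟩
      r + sumFromTo k m term      ≤⟨ +-mono-≤ r≤ (sumFromTo-mono k m term _ term≤) ⟩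
      ⟦ replicate k 1 ++ (0 ∷ []) ⟧ q + repunitTail q k m  <⟨ part-i q≥2 k m (<⇒≤ k<m) ⟩
      q ^ suc m ∸ 1               ∎
      where open ≤-Reasoning

    upper : ∀ j → q ^ j ∸ 1 ≤ r + sumFromTo k N term → j ≤ m
    upper j qj≤b with j ≤? m
    ... | yes j≤m = j≤m
    ... | no j≰m = contradiction (≤-trans (∸-monoˡ-≤ 1 (^-monoʳ-≤ q (≰⇒> j≰m))) qj≤b) (<⇒≱ below-next)
      where instance _ = >-nonZero (≤-trans (s≤s z≤n) q≥2)

lemma2 : (q s : ℕ) → 2 ≤ q → IsPrimePower q → 1 < s → s < q →
    ((k l : ℕ) → 1 ≤ k → k ≤ l →
    ⟦ replicate k 1 ++ (0 ∷ []) ⟧ q + sumFromTo k l (λ j → q ^ j ∸ 1) < q ^ suc l ∸ 1)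
    ×
    ((k b r : ℕ) (ε : ℕ → ℕ) (N : ℕ) → 1 ≤ k → 1 ≤ b →
    ⟦ replicate k (q ∸ s) ⟧ q ≤ r → r ≤ ⟦ replicate k 1 ++ (0 ∷ []) ⟧ q →
    (∀ j → suc k ≤ j → ε j ≡ 0 ⊎ ε j ≡ 1) →
    (Σ ℕ λ j → suc k ≤ j × ε j ≡ 1) →
    (∀ j → N < j → ε j ≡ 0) →
    b ≡ r + sumFromTo k N (λ j → ε j * (q ^ j ∸ 1)) →
    (m : ℕ) → IsMax (λ j → suc k ≤ j × ε j ≡ 1) m →
    IsMax (λ j → q ^ j ∸ 1 ≤ b) m)
lemma2 q s q≥2 _ _ _ =
    (λ k l _ k≤l → part-i q≥2 k l k≤l)
  , (λ k b r ε N _ _ _ r≤ binary _ finite b≡ → part-ii q≥2 k b r ε N r≤ binary finite b≡)
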